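{- Let $q$ be a power of two, $A$ a $q$-modular witness in a graph $G$, $d$ a lift modulo $2q$ of the common residue modulo $q$ of the degrees $\deg_A(v)$, and $b_A(v)\in\{0,1\}$ with $\deg_A(v)\equiv d+qb_A(v)\pmod{2q}$. Let $U\subseteq A$, $u_0\in U$, and suppose $D=A\setminus U$ is partitioned into blocks of size $q$, each block consisting of vertices with a common trace on $U$. Assume: (1) for each $u\in U\setminus\{u_0\}$, the number of blocks with trace $\{u\}$ is congruent to $b_A(u)+b_A(u_0)$ modulo $2$; (2) the sum of $[\mathbf 1_{B}]$ over all remaining blocks (those whose trace $B$ is not a singleton $\{u\}$ with $u\ne u_0$; this includes traces $\{u_0\}$, $\varnothing$, $U$ and all non-singleton traces), counted with multiplicity, is zero in $\mathbb F_2^U/\langle\mathbf 1_U\rangle$. Then $U$ is $2q$-modular. In particular, if $|U|\le2q$ then $G[U]$ is regular.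
   Context: Graphs are finite simple; $\deg_S(v)$ is the degree of $v$ in $G[S]$; $S$ is $q$-modular if all $\deg_S(v)$, $v\in S$, are congruent modulo $q$. The trace of $x$ on $U$ is $N(x)\cap U$. $\mathbf 1_B\in\mathbb F_2^U$ is the indicator of $B$; quotient by the constant vector $\mathbf 1_U$. -}

module Defs where

open import Data.Nat using (ℕ; zero; suc; _+_; _*_)
open import Data.Bool using (Bool; true; false; _xor_; if_then_else_)
import Data.Bool.Properties as BoolP
open import Data.Fin using (Fin; zero; suc)
import Data.Fin.Properties as FinP
open import Data.Fin.Subset using (Subset; _∈_; _∉_; _∩_; ∣_∣; ⊥; ⁅_⁆)
open import Data.Fin.Subset.Properties using (_∈?_)
open import Data.Vec using (Vec; tabulate; zipWith)
import Data.Vec.Properties as VecP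
open import Data.Product using (Σ; ∃; ∃₂; _×_; _,_)
open import Relation.Binary.PropositionalEquality using (_≡_; _≢_)
open import Relation.Nullary using (Dec; ¬_; ⌊_⌋)
open import Relation.Nullary.Decidable using (_×-dec_; ¬?)

_≡_[mod_] : ℕ → ℕ → ℕ → Set
a ≡ b [mod n ] = ∃₂ λ x y → a + x * n ≡ b + y * n

record Graph (n : ℕ) : Set where
  field
    adj   : Fin n → Fin n → Bool
    sym   : ∀ v w → adj v w ≡ adj w v
    irrefl : ∀ v → adj v v ≡ false
open Graph public

N : ∀ {n} → Graph n → Fin n → Subset n
N G v = tabulate (adj G v)

deg : ∀ {n} → Graph n → Subset n → Fin n → ℕ
deg G S v = ∣ N G v ∩ S ∣

IsModular : ∀ {n} → Graph n → ℕ → Subset n → Set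
IsModular G q S = ∀ v w → v ∈ S → w ∈ S → deg G S v ≡ deg G S w [mod q ]

IsRegular : ∀ {n} → Graph n → Subset n → Set
IsRegular G S = ∀ v w → v ∈ S → w ∈ S → deg G S v ≡ deg G S w

trace : ∀ {n} → Graph n → Subset n → Fin n → Subset n
trace G U x = N G x ∩ U

_⊕_ : ∀ {n} → Subset n → Subset n → Subset n
_⊕_ = zipWith _xor_

⊕-sum : ∀ {n m} → (Fin m → Subset n) → Subset n
⊕-sum {m = zero}  f = ⊥
⊕-sum {m = suc m} f = f zero ⊕ ⊕-sum (λ i → f (suc i))

OtherSingleton : ∀ {n} → Subset n → Fin n → Subset n → Set
OtherSingleton U u0 B = ∃ λ u → u ∈ U × u ≢ u0 × B ≡ ⁅ u ⁆

otherSingleton? : ∀ {n} (U : Subset n) (u0 : Fin n) (B : Subset n) →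
                  Dec (OtherSingleton U u0 B)
otherSingleton? U u0 B =
  FinP.any? (λ u → (u ∈? U) ×-dec (¬? (u FinP.≟ u0) ×-dec VecP.≡-dec BoolP._≟_ B ⁅ u ⁆))

countTrace : ∀ {n m} → (Fin m → Subset n) → Subset n → ℕ
countTrace T B = ∣ tabulate (λ i → ⌊ VecP.≡-dec BoolP._≟_ (T i) B ⌋) ∣

remainingSum : ∀ {n m} → Subset n → Fin n → (Fin m → Subset n) → Subset n
remainingSum U u0 T =
  ⊕-sum (λ i → if ⌊ otherSingleton? U u0 (T i) ⌋ then ⊥ else T i)

-- A vector S ∈ F_2^U (given by its support, restricted to U) is zero in
-- F_2^U / ⟨1_U⟩ iff its restriction to U is 0 or 1_U.
ZeroModAllOnes : ∀ {n} → Subset n → Subset n → Set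
ZeroModAllOnes U S = ((S ∩ U) ≡ ⊥) Data.Sum.⊎ ((S ∩ U) ≡ U)
  where import Data.Sum

-- For u ∈ U each block lies entirely inside or entirely outside N(u), so
-- deg_A(u) = deg_U(u) + q·c(u), where c(u) counts the blocks whose trace
-- contains u. As deg_A(u) ≡ d + q·b(u) (mod 2q), U is 2q-modular once
-- c(u) + b(u) has the same parity for all u ∈ U. The blocks with trace {u},
-- u ≠ u0, contribute b(u) + b(u0) by (1), and none of them contains u0; the
-- remaining blocks contribute, mod 2, the u-coordinate of their F₂-sum, which
-- is constant on U by (2). So c(u) + b(u) ≡ b(u0) + const. Regularity follows
-- since degrees in G[U] are below |U| ≤ 2q.

module Submission where

open import Defs hiding (sym)
open import Data.Nat.Properties using (+-*-semiring; *-comm; *-distribˡ-+; *-zeroʳ; +-identityʳ; +-cancelʳ-≡; <-≤-trans)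
open import Algebra.Properties.Semiring.Sum +-*-semiring
  using (sum-syntax; sum-cong-≗; sum-replicate-zero; ∑-distrib-+; ∑-comm; *-distribˡ-sum; *-distribʳ-sum)
open import Data.Bool using (Bool; true; false; _∧_; _xor_; if_then_else_)
open import Data.Bool.Properties using (∧-identityʳ; _≟_)
open import Data.Empty using (⊥-elim)
open import Data.Fin using (Fin; zero; suc)
import Data.Fin.Properties as FinP
open import Data.Fin.Subset using (Subset; _∈_; _∉_; _⊆_; _∩_; ∣_∣; ⊥; ⁅_⁆)
open import Data.Fin.Subset.Properties using (x∈⁅x⁆; x∈⁅y⁆⇒x≡y; x∈p∩q⁻; p∩q⊆q; p⊂q⇒∣p∣<∣q∣)
open import Data.Nat using (ℕ; zero; suc; _+_; _*_; _^_; _≤_; _<_; _%_)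
open import Data.Nat.DivMod using ([m+kn]%n≡m%n; m<n⇒m%n≡m)
open import Data.Nat.Tactic.RingSolver using (solve-∀)
open import Data.Product using (∃; _×_; _,_; proj₁; proj₂)
open import Data.Sum using (inj₁; inj₂)
open import Data.Vec using ([]; _∷_; lookup; tabulate)
open import Data.Vec.Properties using (≡-dec; lookup-zipWith; lookup∘tabulate; lookup-replicate; []=⇒lookup; lookup⇒[]=)
open import Function.Bundles using (_⇔_; Equivalence)
open import Level using (0ℓ)
open import Relation.Binary.Bundles using (Setoid)
open import Relation.Binary.PropositionalEquality
  using (_≡_; _≢_; refl; sym; trans; cong; cong₂; module ≡-Reasoning)
open import Relation.Nullary using (¬_; yes; no; ⌊_⌋)

≡-mod-refl : ∀ {n a} → a ≡ a [mod n ]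
≡-mod-refl = 0 , 0 , refl

≡⇒≡-mod : ∀ {n a b} → a ≡ b → a ≡ b [mod n ]
≡⇒≡-mod refl = ≡-mod-refl

≡-mod-sym : ∀ {n a b} → a ≡ b [mod n ] → b ≡ a [mod n ]
≡-mod-sym (x , y , e) = y , x , sym e

≡-mod-trans : ∀ {n a b c} → a ≡ b [mod n ] → b ≡ c [mod n ] → a ≡ c [mod n ]
≡-mod-trans {n} {a} {b} {c} (x , y , e) (x′ , y′ , e′) = x + x′ , y′ + y , (begin
  a + (x + x′) * n      ≡⟨ regroup a x x′ n ⟩
  (a + x * n) + x′ * n  ≡⟨ cong (_+ x′ * n) e ⟩
  (b + y * n) + x′ * n  ≡⟨ regroup′ b y x′ n ⟩
  (b + x′ * n) + y * n  ≡⟨ cong (_+ y * n) e′ ⟩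
  (c + y′ * n) + y * n  ≡⟨ regroup c y′ y n ⟨
  c + (y′ + y) * n      ∎)
  where
  open ≡-Reasoning
  regroup : ∀ a x x′ n → a + (x + x′) * n ≡ (a + x * n) + x′ * n
  regroup = solve-∀
  regroup′ : ∀ b y x′ n → (b + y * n) + x′ * n ≡ (b + x′ * n) + y * n
  regroup′ = solve-∀

≡-mod-setoid : ℕ → Setoid 0ℓ 0ℓ
≡-mod-setoid n = record
  { Carrier       = ℕ
  ; _≈_           = λ a b → a ≡ b [mod n ]
  ; isEquivalence = record { refl = ≡-mod-refl ; sym = ≡-mod-sym ; trans = ≡-mod-trans }
  }

module ≡-mod-Reasoning (n : ℕ) where
  open import Relation.Binary.Reasoning.Setoid (≡-mod-setoid n) public

+-cong-mod : ∀ {n a b c d} → a ≡ b [mod n ] → c ≡ d [mod n ] → (a + c) ≡ b + d [mod n ]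
+-cong-mod {n} {a} {b} {c} {d} (x , y , e) (x′ , y′ , e′) = x + x′ , y + y′ , (begin
  a + c + (x + x′) * n        ≡⟨ regroup a c x x′ n ⟩
  (a + x * n) + (c + x′ * n)  ≡⟨ cong₂ _+_ e e′ ⟩
  (b + y * n) + (d + y′ * n)  ≡⟨ regroup b d y y′ n ⟨
  b + d + (y + y′) * n        ∎)
  where
  open ≡-Reasoning
  regroup : ∀ a c x x′ n → a + c + (x + x′) * n ≡ (a + x * n) + (c + x′ * n)
  regroup = solve-∀

+-cancelʳ-mod : ∀ {n a b} c → (a + c) ≡ b + c [mod n ] → a ≡ b [mod n ]
+-cancelʳ-mod {n} {a} {b} c (x , y , e) = x , y , +-cancelʳ-≡ c _ _ (begin
  a + x * n + c  ≡⟨ regroup a x n c ⟩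
  a + c + x * n  ≡⟨ e ⟩
  b + c + y * n  ≡⟨ regroup b y n c ⟨
  b + y * n + c  ∎)
  where
  open ≡-Reasoning
  regroup : ∀ a x n c → a + x * n + c ≡ a + c + x * n
  regroup = solve-∀

m+kn≡m-mod : ∀ {n} m k → (m + k * n) ≡ m [mod n ]
m+kn≡m-mod m k = 0 , k , +-identityʳ _

*-cong-mod : ∀ {n a b} c → a ≡ b [mod n ] → (c * a) ≡ c * b [mod n * c ]
*-cong-mod {n} {a} {b} c (x , y , e) = x , y , (begin
  c * a + x * (n * c)  ≡⟨ regroup c a x n ⟩
  c * (a + x * n)      ≡⟨ cong (c *_) e ⟩
  c * (b + y * n)      ≡⟨ regroup c b y n ⟨
  c * b + y * (n * c)  ∎)
  where
  open ≡-Reasoning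
  regroup : ∀ c a x n → c * a + x * (n * c) ≡ c * (a + x * n)
  regroup = solve-∀

≡-mod⇒≡ : ∀ {n a b} → a < n → b < n → a ≡ b [mod n ] → a ≡ b
≡-mod⇒≡ {suc n} {a} {b} a<n b<n (x , y , e) = begin
  a                        ≡⟨ m<n⇒m%n≡m a<n ⟨
  a % suc n                ≡⟨ [m+kn]%n≡m%n a x (suc n) ⟨
  (a + x * suc n) % suc n  ≡⟨ cong (_% suc n) e ⟩
  (b + y * suc n) % suc n  ≡⟨ [m+kn]%n≡m%n b y (suc n) ⟩
  b % suc n                ≡⟨ m<n⇒m%n≡m b<n ⟩
  b                        ∎
  where open ≡-Reasoning

∈⇒lookup : ∀ {n} {x : Fin n} {p : Subset n} → x ∈ p → lookup p x ≡ true
∈⇒lookup = []=⇒lookup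

lookup⇒∈ : ∀ {n} {x : Fin n} {p : Subset n} → lookup p x ≡ true → x ∈ p
lookup⇒∈ {x = x} {p} = lookup⇒[]= x p

lookup≡false⇒∉ : ∀ {n} {x : Fin n} {p : Subset n} → lookup p x ≡ false → x ∉ p
lookup≡false⇒∉ p[x]≡false x∈p with () ← trans (sym (∈⇒lookup x∈p)) p[x]≡false

∉⇒lookup≡false : ∀ {n} {x : Fin n} {p : Subset n} → x ∉ p → lookup p x ≡ false
∉⇒lookup≡false {x = x} {p} x∉p with lookup p x in p[x]
... | false = refl
... | true  = ⊥-elim (x∉p (lookup⇒∈ p[x]))

lookup-∩ : ∀ {n} (p q : Subset n) x → lookup (p ∩ q) x ≡ lookup p x ∧ lookup q x
lookup-∩ p q x = lookup-zipWith _∧_ x p q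

lookup-∩-∈ : ∀ {n} (p : Subset n) {q x} → x ∈ q → lookup (p ∩ q) x ≡ lookup p x
lookup-∩-∈ p {q} {x} x∈q =
  trans (lookup-∩ p q x) (trans (cong (lookup p x ∧_) (∈⇒lookup x∈q)) (∧-identityʳ (lookup p x)))

toℕ : Bool → ℕ
toℕ true  = 1
toℕ false = 0

toℕ-∧ : ∀ a b → toℕ (a ∧ b) ≡ toℕ a * toℕ b
toℕ-∧ true  b = sym (+-identityʳ (toℕ b))
toℕ-∧ false b = refl

toℕ-xor : ∀ a b → (toℕ a + toℕ b) ≡ toℕ (a xor b) [mod 2 ]
toℕ-xor true  true  = 0 , 1 , refl
toℕ-xor true  false = ≡-mod-refl
toℕ-xor false b     = ≡-mod-refl

∣p∣≡∑toℕ : ∀ {n} (p : Subset n) → ∣ p ∣ ≡ ∑[ x < n ] toℕ (lookup p x)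
∣p∣≡∑toℕ []          = refl
∣p∣≡∑toℕ (true ∷ p)  = cong suc (∣p∣≡∑toℕ p)
∣p∣≡∑toℕ (false ∷ p) = ∣p∣≡∑toℕ p

∑toℕ-none : ∀ {m} (f : Fin m → Bool) → (∀ i → f i ≡ false) → ∑[ i < m ] toℕ (f i) ≡ 0
∑toℕ-none {m} f none = trans (sum-cong-≗ (λ i → cong toℕ (none i))) (sum-replicate-zero m)

∑toℕ-unique : ∀ {m} (f : Fin m → Bool) i₀ → f i₀ ≡ true → (∀ j → f j ≡ true → j ≡ i₀) →
              ∑[ i < m ] toℕ (f i) ≡ 1
∑toℕ-unique f zero fi₀ unique rewrite fi₀ =
  cong suc (∑toℕ-none (λ i → f (suc i)) others-false)
  where
  others-false : ∀ i → f (suc i) ≡ false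
  others-false i with f (suc i) in fi
  ... | false = refl
  ... | true  with () ← unique (suc i) fi
∑toℕ-unique f (suc i₀) fi₀ unique with f zero in f0
... | true  with () ← unique zero f0
... | false = ∑toℕ-unique (λ i → f (suc i)) i₀ fi₀ (λ j fj → FinP.suc-injective (unique (suc j) fj))

∑toℕ≡⊕-sum : ∀ {n m} (f : Fin m → Subset n) x →
             (∑[ i < m ] toℕ (lookup (f i) x)) ≡ toℕ (lookup (⊕-sum f) x) [mod 2 ]
∑toℕ≡⊕-sum {m = zero}  f x = ≡⇒≡-mod (cong toℕ (sym (lookup-replicate x false)))
∑toℕ≡⊕-sum {m = suc m} f x = begin
  toℕ (lookup (f zero) x) + ∑[ i < m ] toℕ (lookup (f (suc i)) x)
    ≈⟨ +-cong-mod ≡-mod-refl (∑toℕ≡⊕-sum (λ i → f (suc i)) x) ⟩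
  toℕ (lookup (f zero) x) + toℕ (lookup (⊕-sum (λ i → f (suc i))) x)
    ≈⟨ toℕ-xor (lookup (f zero) x) (lookup (⊕-sum (λ i → f (suc i))) x) ⟩
  toℕ (lookup (f zero) x xor lookup (⊕-sum (λ i → f (suc i))) x)
    ≡⟨ cong toℕ (lookup-zipWith _xor_ x (f zero) _) ⟨
  toℕ (lookup (⊕-sum f) x) ∎
  where open ≡-mod-Reasoning 2

lookup-N : ∀ {n} (G : Graph n) v x → lookup (N G v) x ≡ adj G v x
lookup-N G v x = lookup∘tabulate (adj G v) x

deg≡∑ : ∀ {n} (G : Graph n) S v → deg G S v ≡ ∑[ x < n ] (toℕ (adj G v x) * toℕ (lookup S x))
deg≡∑ G S v = trans (∣p∣≡∑toℕ (N G v ∩ S)) (sum-cong-≗ λ x → begin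
  toℕ (lookup (N G v ∩ S) x)                 ≡⟨ cong toℕ (lookup-∩ (N G v) S x) ⟩
  toℕ (lookup (N G v) x ∧ lookup S x)        ≡⟨ toℕ-∧ (lookup (N G v) x) (lookup S x) ⟩
  toℕ (lookup (N G v) x) * toℕ (lookup S x)  ≡⟨ cong (λ a → toℕ a * toℕ (lookup S x)) (lookup-N G v x) ⟩
  toℕ (adj G v x) * toℕ (lookup S x)         ∎)
  where open ≡-Reasoning

deg<∣S∣ : ∀ {n} (G : Graph n) S v → v ∈ S → deg G S v < ∣ S ∣
deg<∣S∣ G S v v∈S = p⊂q⇒∣p∣<∣q∣ (p∩q⊆q (N G v) S , v , v∈S , v∉N[v])
  where
  v∉N[v] : v ∉ N G v ∩ S
  v∉N[v] v∈N[v]∩S =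
    lookup≡false⇒∉ (trans (lookup-N G v v) (irrefl G v)) (proj₁ (x∈p∩q⁻ (N G v) S v∈N[v]∩S))

common-shift⇒modular : ∀ {n q} (G : Graph n) U {c d} →
  (∀ u → u ∈ U → (deg G U u + c) ≡ d [mod q ]) → IsModular G q U
common-shift⇒modular G U {c} shifted v w v∈U w∈U =
  +-cancelʳ-mod c (≡-mod-trans (shifted v v∈U) (≡-mod-sym (shifted w w∈U)))

modular⇒regular : ∀ {n q} (G : Graph n) U → IsModular G q U → ∣ U ∣ ≤ q → IsRegular G U
modular⇒regular G U modular ∣U∣≤q v w v∈U w∈U =
  ≡-mod⇒≡ (<-≤-trans (deg<∣S∣ G U v v∈U) ∣U∣≤q) (<-≤-trans (deg<∣S∣ G U w w∈U) ∣U∣≤q)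
          (modular v w v∈U w∈U)

module BlockDecomposition
  {n m} (G : Graph n) (A U : Subset n) (q : ℕ) (blk T : Fin m → Subset n)
  (U⊆A : U ⊆ A)
  (∣blk∣≡q : ∀ i → ∣ blk i ∣ ≡ q)
  (blk-disjoint : ∀ i j v → v ∈ blk i → v ∈ blk j → i ≡ j)
  (blk-cover : ∀ v → ((v ∈ A) × (v ∉ U)) ⇔ (∃ λ i → v ∈ blk i))
  (blk-trace : ∀ i v → v ∈ blk i → trace G U v ≡ T i)
  where

  blocksContaining : Fin n → ℕ
  blocksContaining x = ∑[ i < m ] toℕ (lookup (blk i) x)

  blocksContaining-∉ : ∀ x → ¬ ((x ∈ A) × (x ∉ U)) → blocksContaining x ≡ 0
  blocksContaining-∉ x x∉A∖U = ∑toℕ-none (λ i → lookup (blk i) x)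
    (λ i → ∉⇒lookup≡false (λ x∈blk → x∉A∖U (Equivalence.from (blk-cover x) (i , x∈blk))))

  blocksContaining-∈ : ∀ x → x ∈ A → x ∉ U → blocksContaining x ≡ 1
  blocksContaining-∈ x x∈A x∉U with Equivalence.to (blk-cover x) (x∈A , x∉U)
  ... | i , x∈blk = ∑toℕ-unique (λ j → lookup (blk j) x) i (∈⇒lookup x∈blk)
                      (λ j x∈blkj → blk-disjoint j i x (lookup⇒∈ x∈blkj) x∈blk)

  toℕ-lookup-A : ∀ x → toℕ (lookup A x) ≡ toℕ (lookup U x) + blocksContaining x
  toℕ-lookup-A x with lookup U x in U[x] | lookup A x in A[x]
  ... | true  | true  = cong suc (sym (blocksContaining-∉ x (λ (_ , x∉U) → x∉U (lookup⇒∈ U[x]))))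
  ... | true  | false = ⊥-elim (lookup≡false⇒∉ A[x] (U⊆A (lookup⇒∈ U[x])))
  ... | false | false = sym (blocksContaining-∉ x (λ (x∈A , _) → lookup≡false⇒∉ A[x] x∈A))
  ... | false | true  = sym (blocksContaining-∈ x (lookup⇒∈ A[x]) (lookup≡false⇒∉ U[x]))

  adj-from-block : ∀ {u x} i → u ∈ U → x ∈ blk i → adj G u x ≡ lookup (T i) u
  adj-from-block {u} {x} i u∈U x∈blk = begin
    adj G u x                      ≡⟨ Graph.sym G u x ⟩
    adj G x u                      ≡⟨ lookup-N G x u ⟨
    lookup (N G x) u               ≡⟨ lookup-∩-∈ (N G x) u∈U ⟨
    lookup (trace G U x) u         ≡⟨ cong (λ B → lookup B u) (blk-trace i x x∈blk) ⟩
    lookup (T i) u                 ∎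
    where open ≡-Reasoning

  toℕ-adj-in-block : ∀ {u} → u ∈ U → ∀ i x →
    toℕ (adj G u x) * toℕ (lookup (blk i) x) ≡ toℕ (lookup (T i) u) * toℕ (lookup (blk i) x)
  toℕ-adj-in-block {u} u∈U i x with lookup (blk i) x in x∈blk
  ... | false = trans (*-zeroʳ (toℕ (adj G u x))) (sym (*-zeroʳ (toℕ (lookup (T i) u))))
  ... | true  = cong (λ a → toℕ a * 1) (adj-from-block i u∈U (lookup⇒∈ x∈blk))

  ∑adj-blocksContaining : ∀ {u} → u ∈ U →
    ∑[ x < n ] (toℕ (adj G u x) * blocksContaining x) ≡ q * ∑[ i < m ] toℕ (lookup (T i) u)
  ∑adj-blocksContaining {u} u∈U = begin
    ∑[ x < n ] (toℕ (adj G u x) * ∑[ i < m ] toℕ (lookup (blk i) x))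
      ≡⟨ sum-cong-≗ (λ x → *-distribˡ-sum (toℕ (adj G u x)) (λ i → toℕ (lookup (blk i) x))) ⟩
    ∑[ x < n ] ∑[ i < m ] (toℕ (adj G u x) * toℕ (lookup (blk i) x))
      ≡⟨ ∑-comm (λ x i → toℕ (adj G u x) * toℕ (lookup (blk i) x)) ⟩
    ∑[ i < m ] ∑[ x < n ] (toℕ (adj G u x) * toℕ (lookup (blk i) x))
      ≡⟨ sum-cong-≗ (λ i → sum-cong-≗ (toℕ-adj-in-block u∈U i)) ⟩
    ∑[ i < m ] ∑[ x < n ] (toℕ (lookup (T i) u) * toℕ (lookup (blk i) x))
      ≡⟨ sum-cong-≗ (λ i → *-distribˡ-sum (toℕ (lookup (T i) u)) (λ x → toℕ (lookup (blk i) x))) ⟨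
    ∑[ i < m ] (toℕ (lookup (T i) u) * ∑[ x < n ] toℕ (lookup (blk i) x))
      ≡⟨ sum-cong-≗ (λ i → cong (toℕ (lookup (T i) u) *_) (trans (sym (∣p∣≡∑toℕ (blk i))) (∣blk∣≡q i))) ⟩
    ∑[ i < m ] (toℕ (lookup (T i) u) * q)
      ≡⟨ *-distribʳ-sum q (λ i → toℕ (lookup (T i) u)) ⟨
    (∑[ i < m ] toℕ (lookup (T i) u)) * q
      ≡⟨ *-comm _ q ⟩
    q * ∑[ i < m ] toℕ (lookup (T i) u)
      ∎
    where open ≡-Reasoning

  deg-decomposition : ∀ {u} → u ∈ U → deg G A u ≡ deg G U u + q * ∑[ i < m ] toℕ (lookup (T i) u)
  deg-decomposition {u} u∈U = begin
    deg G A u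
      ≡⟨ deg≡∑ G A u ⟩
    ∑[ x < n ] (toℕ (adj G u x) * toℕ (lookup A x))
      ≡⟨ sum-cong-≗ (λ x → cong (toℕ (adj G u x) *_) (toℕ-lookup-A x)) ⟩
    ∑[ x < n ] (toℕ (adj G u x) * (toℕ (lookup U x) + blocksContaining x))
      ≡⟨ sum-cong-≗ (λ x → *-distribˡ-+ (toℕ (adj G u x)) (toℕ (lookup U x)) (blocksContaining x)) ⟩
    ∑[ x < n ] (toℕ (adj G u x) * toℕ (lookup U x) + toℕ (adj G u x) * blocksContaining x)
      ≡⟨ ∑-distrib-+ (λ x → toℕ (adj G u x) * toℕ (lookup U x)) (λ x → toℕ (adj G u x) * blocksContaining x) ⟩
    ∑[ x < n ] (toℕ (adj G u x) * toℕ (lookup U x)) + ∑[ x < n ] (toℕ (adj G u x) * blocksContaining x)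
      ≡⟨ cong₂ _+_ (sym (deg≡∑ G U u)) (∑adj-blocksContaining u∈U) ⟩
    deg G U u + q * ∑[ i < m ] toℕ (lookup (T i) u)
      ∎
    where open ≡-Reasoning

  deg-U-mod : ∀ {d b r u} → u ∈ U →
    deg G A u ≡ d + q * b [mod 2 * q ] →
    (∑[ i < m ] toℕ (lookup (T i) u) + b) ≡ r [mod 2 ] →
    (deg G U u + q * r) ≡ d [mod 2 * q ]
  deg-U-mod {d} {b} {r} {u} u∈U deg-A parity = begin
    deg G U u + q * r            ≈⟨ +-cong-mod ≡-mod-refl (*-cong-mod q parity) ⟨
    deg G U u + q * (c + b)      ≡⟨ regroup (deg G U u) q c b ⟩
    (deg G U u + q * c) + q * b  ≡⟨ cong (_+ q * b) (deg-decomposition u∈U) ⟨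
    deg G A u + q * b            ≈⟨ +-cong-mod deg-A ≡-mod-refl ⟩
    d + q * b + q * b            ≡⟨ regroup′ d q b ⟩
    d + b * (2 * q)              ≈⟨ m+kn≡m-mod d b ⟩
    d                            ∎
    where
    open ≡-mod-Reasoning (2 * q)
    c : ℕ
    c = ∑[ i < m ] toℕ (lookup (T i) u)
    regroup : ∀ e q c b → e + q * (c + b) ≡ (e + q * c) + q * b
    regroup = solve-∀
    regroup′ : ∀ d q b → d + q * b + q * b ≡ d + b * (2 * q)
    regroup′ = solve-∀

otherSingleton-∌ : ∀ {n} {U : Subset n} {u0 B} → OtherSingleton U u0 B → lookup B u0 ≡ false
otherSingleton-∌ (w , _ , w≢u0 , refl) = ∉⇒lookup≡false (λ u0∈⁅w⁆ → w≢u0 (sym (x∈⁅y⁆⇒x≡y w u0∈⁅w⁆)))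

otherSingleton-∋ : ∀ {n} {U : Subset n} {u0 B u} → OtherSingleton U u0 B → u ∈ B → B ≡ ⁅ u ⁆
otherSingleton-∋ (w , _ , _ , refl) u∈⁅w⁆ = cong ⁅_⁆ (sym (x∈⁅y⁆⇒x≡y w u∈⁅w⁆))

zeroModAllOnes⇒constant : ∀ {n} {U S : Subset n} → ZeroModAllOnes U S →
                          ∃ λ K → ∀ u → u ∈ U → lookup S u ≡ K
zeroModAllOnes⇒constant {U = U} {S} (inj₁ S∩U≡⊥) = false , λ u u∈U → begin
  lookup S u        ≡⟨ lookup-∩-∈ S u∈U ⟨
  lookup (S ∩ U) u  ≡⟨ cong (λ V → lookup V u) S∩U≡⊥ ⟩
  lookup ⊥ u        ≡⟨ lookup-replicate u false ⟩
  false             ∎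
  where open ≡-Reasoning
zeroModAllOnes⇒constant {U = U} {S} (inj₂ S∩U≡U) = true , λ u u∈U → begin
  lookup S u        ≡⟨ lookup-∩-∈ S u∈U ⟨
  lookup (S ∩ U) u  ≡⟨ cong (λ V → lookup V u) S∩U≡U ⟩
  lookup U u        ≡⟨ ∈⇒lookup u∈U ⟩
  true              ∎
  where open ≡-Reasoning

module RemainingBlocks {n m} (U : Subset n) (u0 : Fin n) (T : Fin m → Subset n) where

  isOtherSingleton : Fin m → Bool
  isOtherSingleton i = ⌊ otherSingleton? U u0 (T i) ⌋

  remainingTrace : Fin m → Subset n
  remainingTrace i = if isOtherSingleton i then ⊥ else T i

  singletonsContaining remainingContaining : Fin n → ℕ
  singletonsContaining u = ∑[ i < m ] toℕ (isOtherSingleton i ∧ lookup (T i) u)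
  remainingContaining  u = ∑[ i < m ] toℕ (lookup (remainingTrace i) u)

  toℕ-lookup-T : ∀ u i →
    toℕ (lookup (T i) u) ≡ toℕ (isOtherSingleton i ∧ lookup (T i) u) + toℕ (lookup (remainingTrace i) u)
  toℕ-lookup-T u i with isOtherSingleton i
  ... | true  = trans (sym (+-identityʳ _))
                  (cong (λ a → toℕ (lookup (T i) u) + toℕ a) (sym (lookup-replicate u false)))
  ... | false = refl

  containing-split : ∀ u → ∑[ i < m ] toℕ (lookup (T i) u) ≡ singletonsContaining u + remainingContaining u
  containing-split u = trans (sum-cong-≗ (toℕ-lookup-T u))
    (∑-distrib-+ (λ i → toℕ (isOtherSingleton i ∧ lookup (T i) u)) (λ i → toℕ (lookup (remainingTrace i) u)))

  singletonsContaining-u0 : singletonsContaining u0 ≡ 0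
  singletonsContaining-u0 = ∑toℕ-none _ not-containing-u0
    where
    not-containing-u0 : ∀ i → isOtherSingleton i ∧ lookup (T i) u0 ≡ false
    not-containing-u0 i with otherSingleton? U u0 (T i)
    ... | yes other = otherSingleton-∌ other
    ... | no  _     = refl

  singletonsContaining-other : ∀ {u} → u ∈ U → u ≢ u0 → singletonsContaining u ≡ countTrace T ⁅ u ⁆
  singletonsContaining-other {u} u∈U u≢u0 =
    trans (sum-cong-≗ λ i → cong toℕ (trans (is-⁅u⁆ i) (sym (lookup∘tabulate _ i))))
          (sym (∣p∣≡∑toℕ (tabulate λ i → ⌊ ≡-dec _≟_ (T i) ⁅ u ⁆ ⌋)))
    where
    is-⁅u⁆ : ∀ i → isOtherSingleton i ∧ lookup (T i) u ≡ ⌊ ≡-dec _≟_ (T i) ⁅ u ⁆ ⌋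
    is-⁅u⁆ i with otherSingleton? U u0 (T i) | ≡-dec _≟_ (T i) ⁅ u ⁆
    ... | yes _      | yes Ti≡⁅u⁆ = trans (cong (λ B → lookup B u) Ti≡⁅u⁆) (∈⇒lookup (x∈⁅x⁆ u))
    ... | yes other  | no  Ti≢⁅u⁆ = ∉⇒lookup≡false (λ u∈Ti → Ti≢⁅u⁆ (otherSingleton-∋ other u∈Ti))
    ... | no  ¬other | yes Ti≡⁅u⁆ = ⊥-elim (¬other (u , u∈U , u≢u0 , Ti≡⁅u⁆))
    ... | no  _      | no  _      = refl

  containing-parity : (b : Fin n → ℕ) →
    (∀ u → u ∈ U → u ≢ u0 → countTrace T ⁅ u ⁆ ≡ b u + b u0 [mod 2 ]) →
    ZeroModAllOnes U (remainingSum U u0 T) →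
    ∃ λ r → ∀ u → u ∈ U → (∑[ i < m ] toℕ (lookup (T i) u) + b u) ≡ r [mod 2 ]
  containing-parity b singleton-counts remaining-zero = b u0 + toℕ K , λ u u∈U → begin
    ∑[ i < m ] toℕ (lookup (T i) u) + b u
      ≡⟨ cong (_+ b u) (containing-split u) ⟩
    singletonsContaining u + remainingContaining u + b u
      ≡⟨ regroup (singletonsContaining u) (remainingContaining u) (b u) ⟩
    (singletonsContaining u + b u) + remainingContaining u
      ≈⟨ +-cong-mod (singletons-parity u u∈U) (remaining-parity u u∈U) ⟩
    b u0 + toℕ K
      ∎
    where
    open ≡-mod-Reasoning 2
    regroup : ∀ s ρ b → s + ρ + b ≡ (s + b) + ρ
    regroup = solve-∀
    regroup′ : ∀ b b0 → b + b0 + b ≡ b0 + b * 2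
    regroup′ = solve-∀

    constant : ∃ λ K → ∀ u → u ∈ U → lookup (remainingSum U u0 T) u ≡ K
    constant = zeroModAllOnes⇒constant remaining-zero

    K : Bool
    K = proj₁ constant

    remaining-parity : ∀ u → u ∈ U → remainingContaining u ≡ toℕ K [mod 2 ]
    remaining-parity u u∈U =
      ≡-mod-trans (∑toℕ≡⊕-sum remainingTrace u) (≡⇒≡-mod (cong toℕ (proj₂ constant u u∈U)))

    singletons-parity : ∀ u → u ∈ U → (singletonsContaining u + b u) ≡ b u0 [mod 2 ]
    singletons-parity u u∈U with u FinP.≟ u0
    ... | yes refl = ≡⇒≡-mod (cong (_+ b u0) singletonsContaining-u0)
    ... | no  u≢u0 = begin
      singletonsContaining u + b u  ≡⟨ cong (_+ b u) (singletonsContaining-other u∈U u≢u0) ⟩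
      countTrace T ⁅ u ⁆ + b u      ≈⟨ +-cong-mod (singleton-counts u u∈U u≢u0) ≡-mod-refl ⟩
      b u + b u0 + b u              ≡⟨ regroup′ (b u) (b u0) ⟩
      b u0 + b u * 2                ≈⟨ m+kn≡m-mod (b u0) (b u) ⟩
      b u0                          ∎

mainTheorem16 :
    ∀ {n} (G : Graph n) (k : ℕ) (A : Subset n) (d : ℕ) (b : Fin n → ℕ)
      (U : Subset n) (u0 : Fin n)
      (m : ℕ) (blk : Fin m → Subset n) (T : Fin m → Subset n) →
    IsModular G (2 ^ k) A →
    (∀ v → v ∈ A → deg G A v ≡ d [mod 2 ^ k ]) →
    (∀ v → v ∈ A → b v ≤ 1) →
    (∀ v → v ∈ A → deg G A v ≡ d + 2 ^ k * b v [mod 2 * 2 ^ k ]) →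
    U ⊆ A →
    u0 ∈ U →
    (∀ i → ∣ blk i ∣ ≡ 2 ^ k) →
    (∀ i j v → v ∈ blk i → v ∈ blk j → i ≡ j) →
    (∀ v → ((v ∈ A) × (v ∉ U)) ⇔ (∃ λ i → v ∈ blk i)) →
    (∀ i v → v ∈ blk i → trace G U v ≡ T i) →
    (∀ u → u ∈ U → u ≢ u0 → countTrace T ⁅ u ⁆ ≡ b u + b u0 [mod 2 ]) →
    ZeroModAllOnes U (remainingSum U u0 T) →
    IsModular G (2 * 2 ^ k) U × (∣ U ∣ ≤ 2 * 2 ^ k → IsRegular G U)
mainTheorem16 G k A d b U u0 m blk T _ _ _ deg≡d+qb U⊆A _
              ∣blk∣≡q blk-disjoint blk-cover blk-trace singleton-counts remaining-zero =
  modular , modular⇒regular G U modular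
  where
  open BlockDecomposition G A U (2 ^ k) blk T U⊆A ∣blk∣≡q blk-disjoint blk-cover blk-trace
  open RemainingBlocks U u0 T

  modular : IsModular G (2 * 2 ^ k) U
  modular = common-shift⇒modular G U λ u u∈U →
    deg-U-mod u∈U (deg≡d+qb u (U⊆A u∈U)) (proj₂ (containing-parity b singleton-counts remaining-zero) u u∈U)
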